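{- Let $\mathcal{H}$ be a hypergraph and let $S,B \subseteq V(\mathcal{H})$. Let $C_1,\ldots,C_k$ be the connected components of the induced hypergraph $\mathcal{H}[S]$, and for each $i\in\{1,\ldots,k\}$ let $\mathcal{H}_i=\{e\in\mathcal{H} \mid e\cap S\in C_i \}$. Then \[ \mathsf{btr}_B(\mathcal{H},S) = \bigotimes_{i=1}^k \mathsf{btr}_{B}(\mathcal{H}_i,S).\]
   Context: A hypergraph $\mathcal{H}$ is a finite collection of subsets (hyperedges) of a finite ground set; the empty hyperedge is allowed and $\mathcal{H}$ may be empty. Its vertex set is $V(\mathcal{H})=\bigcup_{e\in\mathcal{H}} e$. Any subset $\mathcal{H}'\subseteq \mathcal{H}$ is a sub-hypergraph. For $S\subseteq V(\mathcal{H})$, the induced hypergraph is $\mathcal{H}[S]=\{e\cap S\mid e\in\mathcal{H}\}$, and $\mathcal{H}(S)=\{e\in\mathcal{H}\mid e\cap S\neq\emptyset\}$. A walk between two distinct hyperedges $e_1,e_k$ is a sequence $(e_1,x_1,e_2,\ldots,x_{k-1},e_k)$ of hyperedges and vertices with $x_i\in e_i\cap e_{i+1}$; a connected component of $\mathcal{H}$ is a maximal set of hyperedges pairwise connected by walks. A transversal of $\mathcal{H}$ is a set $T\subseteq V(\mathcal{H})$ meeting every hyperedge; $\mathsf{tr}(\mathcal{H})$ is the set of transversals and $\mathsf{mtr}(\mathcal{H})$ the set of inclusion-wise minimal transversals (so $\mathsf{mtr}(\emptyset)=\{\emptyset\}$, and $\mathsf{tr}(\mathcal{H})=\emptyset$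 if $\emptyset\in\mathcal{H}$). For a sub-hypergraph $\mathcal{H}'\subseteq\mathcal{H}$ and $B\subseteq V(\mathcal{H})$, the set of $B$-blocked transversals of $\mathcal{H}'$ is $\mathsf{btr}_B(\mathcal{H}')=\mathsf{tr}(\mathcal{H}')\cap\mathsf{mtr}(\mathcal{H}'\setminus\mathcal{H}'(B))$, i.e. the transversals $T$ of $\mathcal{H}'$ such that every $x\in T$ has a hyperedge $e\in\mathcal{H}'\setminus\mathcal{H}'(B)$ with $e\cap T=\{x\}$. For $S\subseteq V(\mathcal{H})$, $\mathsf{btr}_B(\mathcal{H}',S)=\{T\in\mathsf{btr}_B(\mathcal{H}')\mid T\subseteq S\}$. For families $\mathcal{A}_1,\ldots,\mathcal{A}_k$ of subsets of a set, $\bigotimes_{i=1}^k\mathcal{A}_i$ is $\emptyset$ if some $\mathcal{A}_i=\emptyset$, and otherwise $\{T_1\cup\cdots\cup T_k\mid T_i\in\mathcal{A}_i \text{ for all } i\}$. -}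

module Defs where

open import Data.Nat using (ℕ; zero; suc)
open import Data.Fin using (Fin; zero; suc)
open import Data.Fin.Subset using (Subset; _∈_; _∉_; _⊆_; _∩_; _∪_; Nonempty; Empty; ⊥) public
open import Data.Fin.Subset.Properties using (nonempty?)
open import Data.Bool using (Bool)
open import Data.Bool.Properties renaming (_≟_ to _≟ᵇ_)
open import Data.Vec.Properties using (≡-dec)
open import Data.List using (List; map; filter)
open import Data.List.Membership.Propositional renaming (_∈_ to _∈ˡ_)
import Data.List.Membership.DecPropositional as DecMem
open import Data.Product using (Σ; ∃; ∃-syntax; _×_; _,_)
open import Relation.Nullary using (¬_; Dec)
open import Relation.Nullary.Decidable using (¬?)
open import Relation.Binary.PropositionalEquality using (_≡_)
open import Relation.Binary.Definitions using (DecidableEquality)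
open import Function.Bundles using (_⇔_)

-- Ground set: Fin n.  A hyperedge is a subset of Fin n; a hypergraph is a finite
-- collection of hyperedges, given as a list (read as a set: only membership matters).
Hypergraph : ℕ → Set
Hypergraph n = List (Subset n)

Family : ℕ → Set₁
Family n = Subset n → Set

module _ {n : ℕ} where

  _≟ₛ_ : DecidableEquality (Subset n)
  _≟ₛ_ = ≡-dec _≟ᵇ_

  open DecMem _≟ₛ_ using () renaming (_∈?_ to _∈ˡ?_)

  _∈ₕ_ : Subset n → Hypergraph n → Set
  e ∈ₕ H = e ∈ˡ H

  InV : Hypergraph n → Fin n → Set
  InV H x = ∃[ e ] (e ∈ₕ H × x ∈ e)

  IsTr : Hypergraph n → Subset n → Set
  IsTr H T = (∀ x → x ∈ T → InV H x) × (∀ e → e ∈ₕ H → Nonempty (e ∩ T))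

  IsMtr : Hypergraph n → Subset n → Set
  IsMtr H T = IsTr H T × (∀ T' → T' ⊆ T → IsTr H T' → T' ≡ T)

  meeting : Hypergraph n → Subset n → Hypergraph n
  meeting H B = filter (λ e → nonempty? (e ∩ B)) H

  avoiding : Hypergraph n → Subset n → Hypergraph n
  avoiding H B = filter (λ e → ¬? (nonempty? (e ∩ B))) H

  Btr : Subset n → Hypergraph n → Family n
  Btr B H' T = IsTr H' T × IsMtr (avoiding H' B) T

  BtrS : Subset n → Hypergraph n → Subset n → Family n
  BtrS B H' S T = Btr B H' T × T ⊆ S

  induced : Hypergraph n → Subset n → Hypergraph n
  induced H S = map (λ e → e ∩ S) H

  data Walk (G : Hypergraph n) : Subset n → Subset n → Set where
    here : ∀ {e} → e ∈ₕ G → Walk G e e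
    step : ∀ {e f g} x → e ∈ₕ G → x ∈ e → x ∈ f → Walk G f g → Walk G e g

  SubColl : Hypergraph n → Hypergraph n → Set
  SubColl C G = ∀ e → e ∈ₕ C → e ∈ₕ G

  PairwiseConnected : Hypergraph n → Hypergraph n → Set
  PairwiseConnected G C = ∀ e f → e ∈ₕ C → f ∈ₕ C → Walk G e f

  IsComponent : Hypergraph n → Hypergraph n → Set
  IsComponent G C = SubColl C G × PairwiseConnected G C
    × (∀ C' → SubColl C C' → SubColl C' G → PairwiseConnected G C' → SubColl C' C)

  SameColl : Hypergraph n → Hypergraph n → Set
  SameColl C D = ∀ e → (e ∈ₕ C ⇔ e ∈ₕ D)

  restrictTo : Hypergraph n → Subset n → Hypergraph n → Hypergraph n
  restrictTo H S C = filter (λ e → (e ∩ S) ∈ˡ? C) H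

  bigUnion : ∀ {k} → (Fin k → Subset n) → Subset n
  bigUnion {zero} Ts = ⊥
  bigUnion {suc k} Ts = Ts zero ∪ bigUnion (λ i → Ts (suc i))

  Tensor : ∀ {k} → (Fin k → Family n) → Family n
  Tensor A T = (∀ i → ∃[ U ] A i U)
    × ∃[ Ts ] ((∀ i → A i (Ts i)) × T ≡ bigUnion Ts)

-- A vertex x ∈ S lies in the trace e ∩ S of every hyperedge e through it, so all
-- hyperedges through x fall into the same part Hᵢ.  Hence both conditions defining a
-- B-blocked transversal T ⊆ S (meeting every hyperedge, and each x ∈ T having a private
-- hyperedge disjoint from B) can be checked part by part, with T ∩ V(Cᵢ) in the role
-- of T for Hᵢ.  That every trace lies in some Cᵢ uses that connectivity in a finite
-- hypergraph is decidable, so the component of a hyperedge can be computed.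
module Submission where

open import Defs
open import Data.Nat using (ℕ; _<_)
open import Data.Nat.Induction using (<-wellFounded)
open import Induction.WellFounded using (Acc; acc)
open import Data.Fin using (Fin; zero; suc) renaming (_≟_ to _≟ᶠ_)
open import Data.Fin.Subset using (⋃; _-_)
open import Data.Fin.Subset.Properties
  using (_∈?_; nonempty?; x∈p∩q⁺; x∈p∩q⁻; x∈p∪q⁺; x∈p∪q⁻; ∉⊥; ⊆-antisym; x∈p∧x≢y⇒x∈p-y; x∈p⇒p-x⊂p)
open import Data.List using (List; []; _∷_; filter; length)
open import Data.List.Properties using (filter-notAll)
open import Data.List.Relation.Unary.Any as Any using (Any; here; there; any?)
open import Data.List.Membership.Propositional using (find; lose)
open import Data.List.Membership.Propositional.Properties using (∈-filter⁺; ∈-filter⁻; ∈-map⁺)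
import Data.List.Membership.DecPropositional as DecMembership
open import Data.Product using (∃-syntax; _×_; _,_; proj₁; proj₂)
open import Data.Sum using (_⊎_; inj₁; inj₂; [_,_])
open import Data.Empty using (⊥-elim)
open import Function.Base using (_∘_)
open import Function.Bundles using (_⇔_; mk⇔; Equivalence)
open import Relation.Nullary using (¬_; Dec; yes; no)
open import Relation.Nullary.Decidable using (¬?; _×-dec_)
open import Relation.Binary.PropositionalEquality using (_≡_; _≢_; refl; sym; subst)

private
  variable
    n : ℕ
    x : Fin n
    a e f g : Subset n
    B S T : Subset n
    G G' : Hypergraph n

_∈ₕ?_ : (e : Subset n) (G : Hypergraph n) → Dec (e ∈ₕ G)
_∈ₕ?_ = DecMembership._∈?_ _≟ₛ_

∈-⋃⁺ : ∀ {ps : List (Subset n)} → Any (x ∈_) ps → x ∈ ⋃ ps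
∈-⋃⁺ (here x∈p) = x∈p∪q⁺ (inj₁ x∈p)
∈-⋃⁺ (there x∈ps) = x∈p∪q⁺ (inj₂ (∈-⋃⁺ x∈ps))

∈-⋃⁻ : ∀ (ps : List (Subset n)) → x ∈ ⋃ ps → Any (x ∈_) ps
∈-⋃⁻ [] x∈⊥ = ⊥-elim (∉⊥ x∈⊥)
∈-⋃⁻ (p ∷ ps) x∈p∪⋃ = [ here , there ∘ ∈-⋃⁻ ps ] (x∈p∪q⁻ p (⋃ ps) x∈p∪⋃)

∈-bigUnion⁺ : ∀ {k} (Ts : Fin k → Subset n) i → x ∈ Ts i → x ∈ bigUnion Ts
∈-bigUnion⁺ Ts zero x∈T = x∈p∪q⁺ (inj₁ x∈T)
∈-bigUnion⁺ Ts (suc i) x∈T = x∈p∪q⁺ (inj₂ (∈-bigUnion⁺ (Ts ∘ suc) i x∈T))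

∈-bigUnion⁻ : ∀ {k} (Ts : Fin k → Subset n) → x ∈ bigUnion Ts → ∃[ i ] x ∈ Ts i
∈-bigUnion⁻ {k = ℕ.zero} Ts x∈⊥ = ⊥-elim (∉⊥ x∈⊥)
∈-bigUnion⁻ {k = ℕ.suc k} Ts x∈U with x∈p∪q⁻ (Ts zero) _ x∈U
... | inj₁ x∈T₀ = zero , x∈T₀
... | inj₂ x∈U' = let i , x∈Tᵢ = ∈-bigUnion⁻ (Ts ∘ suc) x∈U' in suc i , x∈Tᵢ

∈-avoiding⁺ : e ∈ₕ G → ¬ Nonempty (e ∩ B) → e ∈ₕ avoiding G B
∈-avoiding⁺ = ∈-filter⁺ (λ e → ¬? (nonempty? (e ∩ _)))

∈-avoiding⁻ : e ∈ₕ avoiding G B → e ∈ₕ G × ¬ Nonempty (e ∩ B)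
∈-avoiding⁻ {G = G} = ∈-filter⁻ (λ e → ¬? (nonempty? (e ∩ _))) {xs = G}

∈-restrictTo⁺ : ∀ {C} → e ∈ₕ G → (e ∩ S) ∈ₕ C → e ∈ₕ restrictTo G S C
∈-restrictTo⁺ {S = S} {C = C} = ∈-filter⁺ (λ e → (e ∩ S) ∈ₕ? C)

∈-restrictTo⁻ : ∀ {C} → e ∈ₕ restrictTo G S C → e ∈ₕ G × (e ∩ S) ∈ₕ C
∈-restrictTo⁻ {G = G} {S = S} {C = C} = ∈-filter⁻ (λ e → (e ∩ S) ∈ₕ? C) {xs = G}

walk-head : Walk G e f → e ∈ₕ G
walk-head (here e∈G) = e∈G
walk-head (step _ e∈G _ _ _) = e∈G

walk-trans : Walk G e f → Walk G f g → Walk G e g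
walk-trans (here _) w = w
walk-trans (step x e∈G x∈e x∈f w) w' = step x e∈G x∈e x∈f (walk-trans w w')

walk-sym : Walk G e f → Walk G f e
walk-sym (here e∈G) = here e∈G
walk-sym (step x e∈G x∈e x∈f w) = walk-trans (walk-sym w) (step x (walk-head w) x∈f x∈e (here e∈G))

walk-mono : SubColl G G' → Walk G e f → Walk G' e f
walk-mono G⊆G' (here e∈G) = here (G⊆G' _ e∈G)
walk-mono G⊆G' (step x e∈G x∈e x∈f w) = step x (G⊆G' _ e∈G) x∈e x∈f (walk-mono G⊆G' w)

infixl 25 _∖ₕ_

_∖ₕ_ : Hypergraph n → Subset n → Hypergraph n
G ∖ₕ e = filter (λ g → ¬? (g ≟ₛ e)) G

∈-∖ₕ⁺ : g ∈ₕ G → g ≢ e → g ∈ₕ G ∖ₕ e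
∈-∖ₕ⁺ = ∈-filter⁺ (λ g → ¬? (g ≟ₛ _))

∈-∖ₕ⁻ : g ∈ₕ G ∖ₕ e → g ∈ₕ G × g ≢ e
∈-∖ₕ⁻ {G = G} = ∈-filter⁻ (λ g → ¬? (g ≟ₛ _)) {xs = G}

∖ₕ-shorter : e ∈ₕ G → length (G ∖ₕ e) < length G
∖ₕ-shorter {G = G} e∈G = filter-notAll (λ g → ¬? (g ≟ₛ _)) G (Any.map (λ g≡e g≢e → g≢e (sym g≡e)) e∈G)

walk-avoiding : Walk G a f → f ≢ e
  → Walk (G ∖ₕ e) a f ⊎ ∃[ g ] (Nonempty (e ∩ g) × Walk (G ∖ₕ e) g f)
walk-avoiding (here f∈G) f≢e = inj₁ (here (∈-∖ₕ⁺ f∈G f≢e))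
walk-avoiding {a = a} {e = e} (step x a∈G x∈a x∈b w) f≢e with walk-avoiding w f≢e
... | inj₂ exit = inj₂ exit
... | inj₁ w' with a ≟ₛ e
...   | yes refl = inj₂ (_ , (x , x∈p∩q⁺ (x∈a , x∈b)) , w')
...   | no a≢e = inj₁ (step x (∈-∖ₕ⁺ a∈G a≢e) x∈a x∈b w')

walk? : ∀ (G : Hypergraph n) e f → Dec (Walk G e f)
walk? G = walk?-acc G (<-wellFounded (length G))
  where
  walk?-acc : ∀ (G : Hypergraph n) → Acc _<_ (length G) → ∀ e f → Dec (Walk G e f)
  walk?-acc G (acc smaller) e f with e ∈ₕ? G | e ≟ₛ f
  ... | no e∉G | _ = no (e∉G ∘ walk-head)
  ... | yes e∈G | yes refl = yes (here e∈G)
  ... | yes e∈G | no e≢f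
    with any? (λ g → nonempty? (e ∩ g) ×-dec walk?-acc (G ∖ₕ e) (smaller (∖ₕ-shorter e∈G)) g f) (G ∖ₕ e)
  ...   | yes found =
    let g , _ , (x , x∈e∩g) , w = find found
        x∈e , x∈g = x∈p∩q⁻ e g x∈e∩g
    in yes (step x e∈G x∈e x∈g (walk-mono (λ _ → proj₁ ∘ ∈-∖ₕ⁻ {G = G}) w))
  ...   | no none = no λ w → [ (λ w' → proj₂ (∈-∖ₕ⁻ {G = G} (walk-head w')) refl)
                             , (λ (g , e∩g≢∅ , w') → none (lose (walk-head w') (e∩g≢∅ , w'))) ]
                             (walk-avoiding w (e≢f ∘ sym))

reachable : Hypergraph n → Subset n → Hypergraph n
reachable G e = filter (walk? G e) G

module _ (G : Hypergraph n) (e : Subset n) where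

  ∈-reachable⁺ : f ∈ₕ G → Walk G e f → f ∈ₕ reachable G e
  ∈-reachable⁺ = ∈-filter⁺ (walk? G e)

  ∈-reachable⁻ : f ∈ₕ reachable G e → f ∈ₕ G × Walk G e f
  ∈-reachable⁻ = ∈-filter⁻ (walk? G e) {xs = G}

  reachable-isComponent : e ∈ₕ G → IsComponent G (reachable G e)
  reachable-isComponent e∈G = (λ _ → proj₁ ∘ ∈-reachable⁻) , connected , maximal
    where
    connected : PairwiseConnected G (reachable G e)
    connected f g f∈R g∈R = walk-trans (walk-sym (proj₂ (∈-reachable⁻ f∈R))) (proj₂ (∈-reachable⁻ g∈R))
    maximal : ∀ D → SubColl (reachable G e) D → SubColl D G → PairwiseConnected G D → SubColl D (reachable G e)
    maximal D R⊆D D⊆G D-connected f f∈D =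
      ∈-reachable⁺ (D⊆G f f∈D) (D-connected e f (R⊆D e (∈-reachable⁺ e∈G (here e∈G))) f∈D)

component-walk-closed : ∀ {D c c'} → IsComponent G D → c ∈ₕ D → Walk G c c' → c' ∈ₕ D
component-walk-closed {G = G} {D} {c} {c'} (D⊆G , D-connected , maximal) c∈D w =
  maximal (c' ∷ D) (λ _ → there) c'∷D⊆G c'∷D-connected c' (here refl)
  where
  c'∷D⊆G : SubColl (c' ∷ D) G
  c'∷D⊆G _ (here refl) = walk-head (walk-sym w)
  c'∷D⊆G d (there d∈D) = D⊆G d d∈D
  c'∷D-connected : PairwiseConnected G (c' ∷ D)
  c'∷D-connected _ _ (here refl) (here refl) = walk-trans (walk-sym w) w
  c'∷D-connected _ d (here refl) (there d∈D) = walk-trans (walk-sym w) (D-connected c d c∈D d∈D)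
  c'∷D-connected d _ (there d∈D) (here refl) = walk-trans (D-connected d c d∈D c∈D) w
  c'∷D-connected d d' (there d∈D) (there d'∈D) = D-connected d d' d∈D d'∈D

module Components {k : ℕ} (G : Hypergraph n) (C : Fin k → Hypergraph n)
  (isComponent : ∀ i → IsComponent G (C i))
  (distinct : ∀ i j → SameColl (C i) (C j) → i ≡ j)
  (complete : ∀ D → IsComponent G D → ∃[ i ] SameColl D (C i)) where

  component-of : f ∈ₕ G → ∃[ i ] f ∈ₕ C i
  component-of {f = f} f∈G =
    let i , R≈Cᵢ = complete (reachable G f) (reachable-isComponent G f f∈G)
    in i , Equivalence.to (R≈Cᵢ f) (∈-reachable⁺ G f f∈G (here f∈G))

  ∈-component⇒∈ : ∀ {i c} → c ∈ₕ C i → c ∈ₕ G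
  ∈-component⇒∈ {i} = proj₁ (isComponent i) _

  walk⇒same-component : ∀ {i j c c'} → c ∈ₕ C i → c' ∈ₕ C j → Walk G c c' → i ≡ j
  walk⇒same-component {i} {j} {c} {c'} c∈Cᵢ c'∈Cⱼ w = distinct i j λ d → mk⇔
    (λ d∈Cᵢ → component-walk-closed (isComponent j) c'∈Cⱼ
                (walk-trans (walk-sym w) (proj₁ (proj₂ (isComponent i)) c d c∈Cᵢ d∈Cᵢ)))
    (λ d∈Cⱼ → component-walk-closed (isComponent i) c∈Cᵢ
                (walk-trans w (proj₁ (proj₂ (isComponent j)) c' d c'∈Cⱼ d∈Cⱼ)))

PrivateEdge : Hypergraph n → Subset n → Fin n → Set
PrivateEdge G T x = ∃[ e ] (e ∈ₕ G × x ∈ e × (∀ y → y ∈ e → y ∈ T → y ≡ x))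

IsMtr⇒privateEdge : IsMtr G T → x ∈ T → PrivateEdge G T x
IsMtr⇒privateEdge {G = G} {T = T} {x = x} ((T⊆V , T-meets) , minimal) x∈T
  with any? (λ e → (x ∈? e) ×-dec ¬? (nonempty? (e ∩ (T - x)))) G
... | yes found = let e , e∈G , x∈e , e∩T-x≡∅ = find found in e , e∈G , x∈e , only-x e∩T-x≡∅
  where
  only-x : ¬ Nonempty (e ∩ (T - x)) → ∀ y → y ∈ e → y ∈ T → y ≡ x
  only-x e∩T-x≡∅ y y∈e y∈T with y ≟ᶠ x
  ... | yes y≡x = y≡x
  ... | no y≢x = ⊥-elim (e∩T-x≡∅ (y , x∈p∩q⁺ (y∈e , x∈p∧x≢y⇒x∈p-y y∈T y≢x)))
... | no none = let z , z∈T , z∉T-x = proj₂ T-x⊂T in ⊥-elim (z∉T-x (subst (z ∈_) (sym T-x≡T) z∈T))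
  where
  T-x⊂T = x∈p⇒p-x⊂p x∈T
  T-x⊆T = proj₁ T-x⊂T
  T-x-meets : ∀ e → e ∈ₕ G → Nonempty (e ∩ (T - x))
  T-x-meets e e∈G with nonempty? (e ∩ (T - x))
  ... | yes e∩T-x≢∅ = e∩T-x≢∅
  ... | no e∩T-x≡∅ with T-meets e e∈G
  ...   | y , y∈e∩T with x∈p∩q⁻ e T y∈e∩T | y ≟ᶠ x
  ...     | y∈e , _ | yes refl = ⊥-elim (none (lose e∈G (y∈e , e∩T-x≡∅)))
  ...     | y∈e , y∈T | no y≢x = ⊥-elim (e∩T-x≡∅ (y , x∈p∩q⁺ (y∈e , x∈p∧x≢y⇒x∈p-y y∈T y≢x)))
  T-x≡T : T - x ≡ T
  T-x≡T = minimal (T - x) T-x⊆T ((λ y y∈T-x → T⊆V y (T-x⊆T y∈T-x)) , T-x-meets)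

privateEdges⇒IsMtr : (∀ x → x ∈ T → PrivateEdge G T x) → (∀ e → e ∈ₕ G → Nonempty (e ∩ T)) → IsMtr G T
privateEdges⇒IsMtr {T = T} {G = G} private-edge T-meets = (T⊆V , T-meets) , minimal
  where
  T⊆V : ∀ x → x ∈ T → InV G x
  T⊆V x x∈T = let e , e∈G , x∈e , _ = private-edge x x∈T in e , e∈G , x∈e
  minimal : ∀ T' → T' ⊆ T → IsTr G T' → T' ≡ T
  minimal T' T'⊆T (_ , T'-meets) = ⊆-antisym T'⊆T λ {x} x∈T →
    let e , e∈G , x∈e , only-x = private-edge x x∈T
        y , y∈e∩T' = T'-meets e e∈G
        y∈e , y∈T' = x∈p∩q⁻ e T' y∈e∩T'
    in subst (_∈ T') (only-x y y∈e (T'⊆T y∈T')) y∈T'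

module Decomposition {k : ℕ} (H : Hypergraph n) (S B : Subset n) (C : Fin k → Hypergraph n)
  (isComponent : ∀ i → IsComponent (induced H S) (C i))
  (distinct : ∀ i j → SameColl (C i) (C j) → i ≡ j)
  (complete : ∀ D → IsComponent (induced H S) D → ∃[ i ] SameColl D (C i)) where

  open Components (induced H S) C isComponent distinct complete

  Hᵢ : Fin k → Hypergraph n
  Hᵢ i = restrictTo H S (C i)

  ∈-Hᵢ⁻ : ∀ {i} → e ∈ₕ Hᵢ i → e ∈ₕ H × (e ∩ S) ∈ₕ C i
  ∈-Hᵢ⁻ = ∈-restrictTo⁻ {G = H}

  trace∈induced : e ∈ₕ H → (e ∩ S) ∈ₕ induced H S
  trace∈induced = ∈-map⁺ (_∩ S)

  ∈-trace⇒∈⋃ : ∀ {i} → (e ∩ S) ∈ₕ C i → x ∈ e → x ∈ S → x ∈ ⋃ (C i)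
  ∈-trace⇒∈⋃ e∩S∈Cᵢ x∈e x∈S = ∈-⋃⁺ (lose e∩S∈Cᵢ (x∈p∩q⁺ (x∈e , x∈S)))

  vertex-of-Cᵢ⇒∈Hᵢ : ∀ {i} → e ∈ₕ H → x ∈ e → x ∈ S → x ∈ ⋃ (C i) → e ∈ₕ Hᵢ i
  vertex-of-Cᵢ⇒∈Hᵢ {x = x} {i = i} e∈H x∈e x∈S x∈⋃Cᵢ =
    let c , c∈Cᵢ , x∈c = find (∈-⋃⁻ (C i) x∈⋃Cᵢ)
    in ∈-restrictTo⁺ e∈H (component-walk-closed (isComponent i) c∈Cᵢ
         (step x (∈-component⇒∈ c∈Cᵢ) x∈c (x∈p∩q⁺ (x∈e , x∈S)) (here (trace∈induced e∈H))))

  InV-Hᵢ⇒∈⋃ : ∀ {i} → x ∈ S → InV (Hᵢ i) x → x ∈ ⋃ (C i)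
  InV-Hᵢ⇒∈⋃ x∈S (e , e∈Hᵢ , x∈e) = ∈-trace⇒∈⋃ (proj₂ (∈-Hᵢ⁻ e∈Hᵢ)) x∈e x∈S

  Hᵢ-disjoint : ∀ {i j} → e ∈ₕ Hᵢ i → e ∈ₕ Hᵢ j → i ≡ j
  Hᵢ-disjoint e∈Hᵢ e∈Hⱼ =
    walk⇒same-component (proj₂ (∈-Hᵢ⁻ e∈Hᵢ)) (proj₂ (∈-Hᵢ⁻ e∈Hⱼ))
      (here (∈-component⇒∈ (proj₂ (∈-Hᵢ⁻ e∈Hᵢ))))

  restrict-btr : BtrS B H S T → ∀ i → BtrS B (Hᵢ i) S (T ∩ ⋃ (C i))
  restrict-btr {T = T} (((T⊆V , T-meets) , T-mtr) , T⊆S) i =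
    ((Tᵢ⊆V , Tᵢ-meets) , privateEdges⇒IsMtr private-edge (λ e → Tᵢ-meets e ∘ proj₁ ∘ ∈-avoiding⁻))
    , T⊆S ∘ Tᵢ⊆T
    where
    Tᵢ⊆T : T ∩ ⋃ (C i) ⊆ T
    Tᵢ⊆T = proj₁ ∘ x∈p∩q⁻ T _
    Tᵢ⊆V : ∀ x → x ∈ T ∩ ⋃ (C i) → InV (Hᵢ i) x
    Tᵢ⊆V x x∈Tᵢ =
      let x∈T , x∈⋃Cᵢ = x∈p∩q⁻ T _ x∈Tᵢ
          e , e∈H , x∈e = T⊆V x x∈T
      in e , vertex-of-Cᵢ⇒∈Hᵢ e∈H x∈e (T⊆S x∈T) x∈⋃Cᵢ , x∈e
    Tᵢ-meets : ∀ e → e ∈ₕ Hᵢ i → Nonempty (e ∩ (T ∩ ⋃ (C i)))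
    Tᵢ-meets e e∈Hᵢ =
      let e∈H , e∩S∈Cᵢ = ∈-Hᵢ⁻ e∈Hᵢ
          y , y∈e∩T = T-meets e e∈H
          y∈e , y∈T = x∈p∩q⁻ e T y∈e∩T
      in y , x∈p∩q⁺ (y∈e , x∈p∩q⁺ (y∈T , ∈-trace⇒∈⋃ e∩S∈Cᵢ y∈e (T⊆S y∈T)))
    private-edge : ∀ x → x ∈ T ∩ ⋃ (C i) → PrivateEdge (avoiding (Hᵢ i) B) (T ∩ ⋃ (C i)) x
    private-edge x x∈Tᵢ =
      let x∈T , x∈⋃Cᵢ = x∈p∩q⁻ T _ x∈Tᵢ
          e , e∈A , x∈e , only-x = IsMtr⇒privateEdge T-mtr x∈T
          e∈H , e∩B≡∅ = ∈-avoiding⁻ e∈A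
      in e , ∈-avoiding⁺ (vertex-of-Cᵢ⇒∈Hᵢ e∈H x∈e (T⊆S x∈T) x∈⋃Cᵢ) e∩B≡∅ , x∈e , λ y y∈e → only-x y y∈e ∘ Tᵢ⊆T

  btr≡bigUnion : BtrS B H S T → T ≡ bigUnion (λ i → T ∩ ⋃ (C i))
  btr≡bigUnion {T = T} (((T⊆V , _) , _) , T⊆S) = ⊆-antisym T⊆⋃Tᵢ ⋃Tᵢ⊆T
    where
    Tᵢ : Fin k → Subset n
    Tᵢ i = T ∩ ⋃ (C i)
    T⊆⋃Tᵢ : T ⊆ bigUnion Tᵢ
    T⊆⋃Tᵢ {x} x∈T =
      let e , e∈H , x∈e = T⊆V x x∈T
          i , e∩S∈Cᵢ = component-of (trace∈induced e∈H)
      in ∈-bigUnion⁺ Tᵢ i (x∈p∩q⁺ (x∈T , ∈-trace⇒∈⋃ e∩S∈Cᵢ x∈e (T⊆S x∈T)))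
    ⋃Tᵢ⊆T : bigUnion Tᵢ ⊆ T
    ⋃Tᵢ⊆T x∈⋃ = let i , x∈Tᵢ = ∈-bigUnion⁻ Tᵢ x∈⋃ in proj₁ (x∈p∩q⁻ T _ x∈Tᵢ)

  bigUnion-btr : (Ts : Fin k → Subset n) → (∀ i → BtrS B (Hᵢ i) S (Ts i)) → BtrS B H S (bigUnion Ts)
  bigUnion-btr Ts btr =
    ((U⊆V , U-meets) , privateEdges⇒IsMtr private-edge (λ e → U-meets e ∘ proj₁ ∘ ∈-avoiding⁻)) , U⊆S
    where
    U = bigUnion Ts
    U⊆S : U ⊆ S
    U⊆S x∈U = let i , x∈Tᵢ = ∈-bigUnion⁻ Ts x∈U in proj₂ (btr i) x∈Tᵢ
    Tᵢ⊆V : ∀ i x → x ∈ Ts i → InV (Hᵢ i) x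
    Tᵢ⊆V i = proj₁ (proj₁ (proj₁ (btr i)))
    U⊆V : ∀ x → x ∈ U → InV H x
    U⊆V x x∈U =
      let i , x∈Tᵢ = ∈-bigUnion⁻ Ts x∈U
          e , e∈Hᵢ , x∈e = Tᵢ⊆V i x x∈Tᵢ
      in e , proj₁ (∈-Hᵢ⁻ e∈Hᵢ) , x∈e
    U-meets : ∀ e → e ∈ₕ H → Nonempty (e ∩ U)
    U-meets e e∈H =
      let i , e∩S∈Cᵢ = component-of (trace∈induced e∈H)
          y , y∈e∩Tᵢ = proj₂ (proj₁ (proj₁ (btr i))) e (∈-restrictTo⁺ e∈H e∩S∈Cᵢ)
          y∈e , y∈Tᵢ = x∈p∩q⁻ e (Ts i) y∈e∩Tᵢ
      in y , x∈p∩q⁺ (y∈e , ∈-bigUnion⁺ Ts i y∈Tᵢ)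
    -- A vertex of Ts j drags every hyperedge through it into Hⱼ, so the private edge
    -- of x in Hᵢ can meet U only inside Ts i.
    private-edge : ∀ x → x ∈ U → PrivateEdge (avoiding H B) U x
    private-edge x x∈U with ∈-bigUnion⁻ Ts x∈U
    ... | i , x∈Tᵢ with IsMtr⇒privateEdge (proj₂ (proj₁ (btr i))) x∈Tᵢ
    ...   | e , e∈A , x∈e , only-x with ∈-avoiding⁻ e∈A
    ...     | e∈Hᵢ , e∩B≡∅ = e , ∈-avoiding⁺ (proj₁ (∈-Hᵢ⁻ e∈Hᵢ)) e∩B≡∅ , x∈e , only-x-in-U
      where
      only-x-in-U : ∀ y → y ∈ e → y ∈ U → y ≡ x
      only-x-in-U y y∈e y∈U with ∈-bigUnion⁻ Ts y∈U
      ... | j , y∈Tⱼ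
        with Hᵢ-disjoint e∈Hᵢ (vertex-of-Cᵢ⇒∈Hᵢ {i = j} (proj₁ (∈-Hᵢ⁻ e∈Hᵢ)) y∈e y∈S y∈⋃Cⱼ)
        where
        y∈S = proj₂ (btr j) y∈Tⱼ
        y∈⋃Cⱼ = InV-Hᵢ⇒∈⋃ y∈S (Tᵢ⊆V j y y∈Tⱼ)
      ...   | refl = only-x y y∈e y∈Tⱼ

lemma1 : ∀ {n : ℕ} (H : Hypergraph n) (S B : Subset n)
    → (∀ x → x ∈ S → InV H x)
    → (∀ x → x ∈ B → InV H x)
    → (k : ℕ) (C : Fin k → Hypergraph n)
    → (∀ i → IsComponent (induced H S) (C i))
    → (∀ i j → SameColl (C i) (C j) → i ≡ j)
    → (∀ D → IsComponent (induced H S) D → ∃[ i ] SameColl D (C i))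
    → ∀ T → (BtrS B H S T ⇔ Tensor (λ i → BtrS B (restrictTo H S (C i)) S) T)
lemma1 H S B _ _ k C isComponent distinct complete T = mk⇔ split glue
  where
  open Decomposition H S B C isComponent distinct complete
  split : BtrS B H S T → Tensor (λ i → BtrS B (Hᵢ i) S) T
  split btr = (λ i → _ , restrict-btr btr i) , _ , restrict-btr btr , btr≡bigUnion btr
  glue : Tensor (λ i → BtrS B (Hᵢ i) S) T → BtrS B H S T
  glue (_ , Ts , btrs , refl) = bigUnion-btr Ts btrs
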